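{- Let $\mathbf A$ be a WHB-algebra. Then: (1) $a\wedge(a\to b)\le b$ holds for all $a,b$ iff $a\le b\vee(a\leftarrow b)$ holds for all $a,b$; (2) $a\to b\le c\to(a\to b)$ holds for all $a,b,c$ iff $(a\leftarrow b)\leftarrow c\le a\leftarrow b$ holds for all $a,b,c$; (3) $a\le 1\to a$ holds for all $a$ iff $a\leftarrow 0\le a$ holds for all $a$.
   Context: A WHB-algebra is an algebra $(A,\wedge,\vee,\to,\leftarrow,0,1)$ such that $(A,\wedge,\vee,0,1)$ is a bounded distributive lattice and for all $a,b,c$: $a\to a=1$; $a\to(b\wedge c)=(a\to b)\wedge(a\to c)$; $(a\vee b)\to c=(a\to c)\wedge(b\to c)$; $(a\to b)\wedge(b\to c)\le a\to c$; $a\leftarrow a=0$; $(a\vee b)\leftarrow c=(a\leftarrow c)\vee(b\leftarrow c)$; $a\leftarrow(b\wedge c)=(a\leftarrow b)\vee(a\leftarrow c)$; $a\leftarrow c\le(a\leftarrow b)\vee(b\leftarrow c)$; $a\wedge((a\to b)\leftarrow 0)\le b$; $a\le b\vee(1\to(a\leftarrow b))$. -}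

module Defs where

open import Level using (Level; _⊔_; suc)
open import Relation.Binary.Core using (Rel)
open import Algebra.Core using (Op₂)
open import Algebra.Definitions using (Congruent₂)
open import Algebra.Lattice.Structures using (IsDistributiveLattice)

record WHBAlgebra (c ℓ : Level) : Set (suc (c ⊔ ℓ)) where
  infixr 7 _∧_
  infixr 6 _∨_
  infixr 5 _⇒_ _⇐_
  infix  4 _≈_ _≤_
  field
    Carrier               : Set c
    _≈_                   : Rel Carrier ℓ
    _∨_                   : Op₂ Carrier
    _∧_                   : Op₂ Carrier
    _⇒_                   : Op₂ Carrier
    _⇐_                   : Op₂ Carrier
    𝟘                     : Carrier
    𝟙                     : Carrier
    isDistributiveLattice : IsDistributiveLattice _≈_ _∨_ _∧_
    ⇒-cong                : Congruent₂ _≈_ _⇒_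
    ⇐-cong                : Congruent₂ _≈_ _⇐_

  _≤_ : Rel Carrier ℓ
  a ≤ b = (a ∧ b) ≈ a

  field
    𝟘-least    : ∀ a → 𝟘 ≤ a
    𝟙-greatest : ∀ a → a ≤ 𝟙
    ⇒-refl     : ∀ a → (a ⇒ a) ≈ 𝟙
    ⇒-∧        : ∀ a b c → (a ⇒ (b ∧ c)) ≈ ((a ⇒ b) ∧ (a ⇒ c))
    ⇒-∨        : ∀ a b c → ((a ∨ b) ⇒ c) ≈ ((a ⇒ c) ∧ (b ⇒ c))
    ⇒-trans    : ∀ a b c → ((a ⇒ b) ∧ (b ⇒ c)) ≤ (a ⇒ c)
    ⇐-refl     : ∀ a → (a ⇐ a) ≈ 𝟘
    ⇐-∨        : ∀ a b c → ((a ∨ b) ⇐ c) ≈ ((a ⇐ c) ∨ (b ⇐ c))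
    ⇐-∧        : ∀ a b c → (a ⇐ (b ∧ c)) ≈ ((a ⇐ b) ∨ (a ⇐ c))
    ⇐-trans    : ∀ a b c → (a ⇐ c) ≤ ((a ⇐ b) ∨ (b ⇐ c))
    link₁      : ∀ a b → (a ∧ ((a ⇒ b) ⇐ 𝟘)) ≤ b
    link₂      : ∀ a b → a ≤ (b ∨ (𝟙 ⇒ (a ⇐ b)))

  open IsDistributiveLattice isDistributiveLattice public

module Submission where

open import Level using (Level; _⊔_)
open import Data.Product using (_×_; _,_)
open import Function.Bundles using (_⇔_; mk⇔; module Equivalence)
open import Algebra.Lattice.Bundles using (Lattice)
import Algebra.Lattice.Properties.Lattice as LatticeProperties
open import Relation.Binary.Bundles using (Poset)
open import Relation.Binary.Structures using (IsPartialOrder)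
import Relation.Binary.Lattice.Structures as Order
open import Defs

-- The key fact is that  x ↦ x ⇐ 𝟘  is left adjoint to  y ↦ 𝟙 ⇒ y  (both linking
-- axioms with 𝟘 resp. 𝟙 plugged in).  Each condition on ⇒ is then the adjoint
-- transpose of its dual condition on ⇐: (3) directly, (1) after instantiating
-- the conditions at 𝟙 resp. 𝟘 and feeding them to the linking axioms, and (2)
-- because every a ⇐ b lies below (𝟙 ⇒ (a ⇐ b)) ⇐ 𝟘 and every a ⇒ b above
-- 𝟙 ⇒ ((a ⇒ b) ⇐ 𝟘).

module WHBOrder {c ℓ : Level} (A : WHBAlgebra c ℓ) where
  open WHBAlgebra A

  private
    lattice : Lattice c ℓ
    lattice = record { isLattice = isLattice }

    -- the library orders a lattice by  x ≈ x ∧ y, the symmetric form of _≤_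
    module ≼ = Order.IsLattice (LatticeProperties.∨-∧-isOrderTheoreticLattice lattice)

  ≤-isPartialOrder : IsPartialOrder _≈_ _≤_
  ≤-isPartialOrder = record
    { isPreorder = record
      { isEquivalence = isEquivalence
      ; reflexive     = λ x≈y → sym (≼.reflexive x≈y)
      ; trans         = λ x≤y y≤z → sym (≼.trans (sym x≤y) (sym y≤z))
      }
    ; antisym = λ x≤y y≤x → ≼.antisym (sym x≤y) (sym y≤x)
    }

  ≤-poset : Poset c ℓ ℓ
  ≤-poset = record { isPartialOrder = ≤-isPartialOrder }

  ≤-isLattice : Order.IsLattice _≈_ _≤_ _∨_ _∧_
  ≤-isLattice = record
    { isPartialOrder = ≤-isPartialOrder
    ; supremum = λ x y → sym (≼.x≤x∨y x y) , sym (≼.y≤x∨y x y)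
                       , λ z x≤z y≤z → sym (≼.∨-least (sym x≤z) (sym y≤z))
    ; infimum  = λ x y → sym (≼.x∧y≤x x y) , sym (≼.x∧y≤y x y)
                       , λ z z≤x z≤y → sym (≼.∧-greatest (sym z≤x) (sym z≤y))
    }

  open Order.IsLattice ≤-isLattice public
    using (x≤x∨y; y≤x∨y; ∨-least; x∧y≤x; x∧y≤y; ∧-greatest)
    renaming (refl to ≤-refl; reflexive to ≤-reflexive; trans to ≤-trans; antisym to ≤-antisym)

  ∨-identityˡ : ∀ x → 𝟘 ∨ x ≈ x
  ∨-identityˡ x = ≤-antisym (∨-least (𝟘-least x) ≤-refl) (y≤x∨y 𝟘 x)

  ∧-identityˡ : ∀ x → 𝟙 ∧ x ≈ x
  ∧-identityˡ x = trans (∧-comm 𝟙 x) (𝟙-greatest x)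

  ∨-monoʳ-≤ : ∀ x {y y′} → y ≤ y′ → x ∨ y ≤ x ∨ y′
  ∨-monoʳ-≤ x y≤y′ = ∨-least (x≤x∨y _ _) (≤-trans y≤y′ (y≤x∨y _ _))

  ∧-monoʳ-≤ : ∀ x {y y′} → y ≤ y′ → x ∧ y ≤ x ∧ y′
  ∧-monoʳ-≤ x y≤y′ = ∧-greatest (x∧y≤x _ _) (≤-trans (x∧y≤y _ _) y≤y′)

  ≤⇒∨≈ : ∀ {x y} → x ≤ y → x ∨ y ≈ y
  ≤⇒∨≈ x≤y = ≤-antisym (∨-least x≤y ≤-refl) (y≤x∨y _ _)

module WHBProperties {c ℓ : Level} (A : WHBAlgebra c ℓ) where
  open WHBAlgebra A
  open WHBOrder A
  open import Relation.Binary.Reasoning.PartialOrder ≤-poset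

  ⇒-antimonoˡ-≤ : ∀ {a a′} b → a ≤ a′ → a′ ⇒ b ≤ a ⇒ b
  ⇒-antimonoˡ-≤ {a} {a′} b a≤a′ = begin
    a′ ⇒ b                ≈⟨ ⇒-cong (≤⇒∨≈ a≤a′) refl ⟨
    (a ∨ a′) ⇒ b          ≈⟨ ⇒-∨ a a′ b ⟩
    (a ⇒ b) ∧ (a′ ⇒ b)    ≤⟨ x∧y≤x _ _ ⟩
    a ⇒ b                 ∎

  ⇒-monoʳ-≤ : ∀ a {b b′} → b ≤ b′ → a ⇒ b ≤ a ⇒ b′
  ⇒-monoʳ-≤ a {b} {b′} b≤b′ = begin
    a ⇒ b                 ≈⟨ ⇒-cong refl b≤b′ ⟨
    a ⇒ (b ∧ b′)          ≈⟨ ⇒-∧ a b b′ ⟩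
    (a ⇒ b) ∧ (a ⇒ b′)    ≤⟨ x∧y≤y _ _ ⟩
    a ⇒ b′                ∎

  ⇐-monoˡ-≤ : ∀ {a a′} b → a ≤ a′ → a ⇐ b ≤ a′ ⇐ b
  ⇐-monoˡ-≤ {a} {a′} b a≤a′ = begin
    a ⇐ b                 ≤⟨ x≤x∨y _ _ ⟩
    (a ⇐ b) ∨ (a′ ⇐ b)    ≈⟨ ⇐-∨ a a′ b ⟨
    (a ∨ a′) ⇐ b          ≈⟨ ⇐-cong (≤⇒∨≈ a≤a′) refl ⟩
    a′ ⇐ b                ∎

  ⇐-antimonoʳ-≤ : ∀ a {b b′} → b ≤ b′ → a ⇐ b′ ≤ a ⇐ b
  ⇐-antimonoʳ-≤ a {b} {b′} b≤b′ = begin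
    a ⇐ b′                ≤⟨ y≤x∨y _ _ ⟩
    (a ⇐ b) ∨ (a ⇐ b′)    ≈⟨ ⇐-∧ a b b′ ⟨
    a ⇐ (b ∧ b′)          ≈⟨ ⇐-cong refl b≤b′ ⟩
    a ⇐ b                 ∎

  ≤-𝟙⇒-⇐𝟘 : ∀ x → x ≤ 𝟙 ⇒ (x ⇐ 𝟘)
  ≤-𝟙⇒-⇐𝟘 x = begin
    x                     ≤⟨ link₂ x 𝟘 ⟩
    𝟘 ∨ (𝟙 ⇒ (x ⇐ 𝟘))     ≈⟨ ∨-identityˡ _ ⟩
    𝟙 ⇒ (x ⇐ 𝟘)           ∎

  𝟙⇒-⇐𝟘-≤ : ∀ y → (𝟙 ⇒ y) ⇐ 𝟘 ≤ y
  𝟙⇒-⇐𝟘-≤ y = begin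
    (𝟙 ⇒ y) ⇐ 𝟘           ≈⟨ ∧-identityˡ _ ⟨
    𝟙 ∧ ((𝟙 ⇒ y) ⇐ 𝟘)     ≤⟨ link₁ 𝟙 y ⟩
    y                     ∎

  ⇐𝟘≤⇔≤𝟙⇒ : ∀ {x y} → (x ⇐ 𝟘 ≤ y) ⇔ (x ≤ 𝟙 ⇒ y)
  ⇐𝟘≤⇔≤𝟙⇒ {x} {y} = mk⇔
    (λ x⇐𝟘≤y → ≤-trans (≤-𝟙⇒-⇐𝟘 x) (⇒-monoʳ-≤ 𝟙 x⇐𝟘≤y))
    (λ x≤𝟙⇒y → ≤-trans (⇐-monoˡ-≤ 𝟘 x≤𝟙⇒y) (𝟙⇒-⇐𝟘-≤ y))

  ⇐-≤-𝟙⇒-⇐𝟘 : ∀ a b → a ⇐ b ≤ (𝟙 ⇒ (a ⇐ b)) ⇐ 𝟘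
  ⇐-≤-𝟙⇒-⇐𝟘 a b = begin
    a ⇐ b                         ≤⟨ ⇐-monoˡ-≤ b (link₂ a b) ⟩
    (b ∨ (𝟙 ⇒ (a ⇐ b))) ⇐ b       ≈⟨ ⇐-∨ b _ b ⟩
    (b ⇐ b) ∨ ((𝟙 ⇒ (a ⇐ b)) ⇐ b) ≈⟨ ∨-cong (⇐-refl b) refl ⟩
    𝟘 ∨ ((𝟙 ⇒ (a ⇐ b)) ⇐ b)       ≈⟨ ∨-identityˡ _ ⟩
    (𝟙 ⇒ (a ⇐ b)) ⇐ b             ≤⟨ ⇐-antimonoʳ-≤ _ (𝟘-least b) ⟩
    (𝟙 ⇒ (a ⇐ b)) ⇐ 𝟘             ∎

  𝟙⇒-⇐𝟘-≤-⇒ : ∀ a b → 𝟙 ⇒ ((a ⇒ b) ⇐ 𝟘) ≤ a ⇒ b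
  𝟙⇒-⇐𝟘-≤-⇒ a b = begin
    𝟙 ⇒ ((a ⇒ b) ⇐ 𝟘)             ≤⟨ ⇒-antimonoˡ-≤ _ (𝟙-greatest a) ⟩
    a ⇒ ((a ⇒ b) ⇐ 𝟘)             ≈⟨ ∧-identityˡ _ ⟨
    𝟙 ∧ (a ⇒ ((a ⇒ b) ⇐ 𝟘))       ≈⟨ ∧-cong (⇒-refl a) refl ⟨
    (a ⇒ a) ∧ (a ⇒ ((a ⇒ b) ⇐ 𝟘)) ≈⟨ ⇒-∧ a a _ ⟨
    a ⇒ (a ∧ ((a ⇒ b) ⇐ 𝟘))       ≤⟨ ⇒-monoʳ-≤ a (link₁ a b) ⟩
    a ⇒ b                         ∎

  ModusPonens : Set (c ⊔ ℓ)
  ModusPonens = ∀ a b → a ∧ (a ⇒ b) ≤ b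

  DualModusPonens : Set (c ⊔ ℓ)
  DualModusPonens = ∀ a b → a ≤ b ∨ (a ⇐ b)

  ⇒-Weakening : Set (c ⊔ ℓ)
  ⇒-Weakening = ∀ a b c → a ⇒ b ≤ c ⇒ (a ⇒ b)

  ⇐-Weakening : Set (c ⊔ ℓ)
  ⇐-Weakening = ∀ a b c → (a ⇐ b) ⇐ c ≤ a ⇐ b

  𝟙⇒-Inflationary : Set (c ⊔ ℓ)
  𝟙⇒-Inflationary = ∀ a → a ≤ 𝟙 ⇒ a

  ⇐𝟘-Deflationary : Set (c ⊔ ℓ)
  ⇐𝟘-Deflationary = ∀ a → a ⇐ 𝟘 ≤ a

  modusPonens⇔dualModusPonens : ModusPonens ⇔ DualModusPonens
  modusPonens⇔dualModusPonens = mk⇔ dualModusPonens modusPonens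
    where
    dualModusPonens : ModusPonens → DualModusPonens
    dualModusPonens mp a b = begin
      a                       ≤⟨ link₂ a b ⟩
      b ∨ (𝟙 ⇒ (a ⇐ b))       ≤⟨ ∨-monoʳ-≤ b 𝟙⇒≤ ⟩
      b ∨ (a ⇐ b)             ∎
      where
      𝟙⇒≤ : 𝟙 ⇒ (a ⇐ b) ≤ a ⇐ b
      𝟙⇒≤ = ≤-trans (≤-reflexive (sym (∧-identityˡ _))) (mp 𝟙 (a ⇐ b))

    modusPonens : DualModusPonens → ModusPonens
    modusPonens dmp a b = begin
      a ∧ (a ⇒ b)             ≤⟨ ∧-monoʳ-≤ a ≤⇐𝟘 ⟩
      a ∧ ((a ⇒ b) ⇐ 𝟘)       ≤⟨ link₁ a b ⟩
      b                       ∎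
      where
      ≤⇐𝟘 : a ⇒ b ≤ (a ⇒ b) ⇐ 𝟘
      ≤⇐𝟘 = ≤-trans (dmp (a ⇒ b) 𝟘) (≤-reflexive (∨-identityˡ _))

  ⇒-weakening⇔⇐-weakening : ⇒-Weakening ⇔ ⇐-Weakening
  ⇒-weakening⇔⇐-weakening = mk⇔ ⇐-weakening ⇒-weakening
    where
    ⇐-weakening : ⇒-Weakening → ⇐-Weakening
    ⇐-weakening weak a b c = begin
      (a ⇐ b) ⇐ c                   ≤⟨ ⇐-antimonoʳ-≤ _ (𝟘-least c) ⟩
      (a ⇐ b) ⇐ 𝟘                   ≤⟨ Equivalence.from ⇐𝟘≤⇔≤𝟙⇒ a⇐b≤𝟙⇒a⇐b ⟩
      a ⇐ b                         ∎
      where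
      a⇐b≤𝟙⇒a⇐b : a ⇐ b ≤ 𝟙 ⇒ (a ⇐ b)
      a⇐b≤𝟙⇒a⇐b = begin
        a ⇐ b                       ≤⟨ ⇐-≤-𝟙⇒-⇐𝟘 a b ⟩
        (𝟙 ⇒ (a ⇐ b)) ⇐ 𝟘           ≤⟨ Equivalence.from ⇐𝟘≤⇔≤𝟙⇒ (weak 𝟙 (a ⇐ b) 𝟙) ⟩
        𝟙 ⇒ (a ⇐ b)                 ∎

    ⇒-weakening : ⇐-Weakening → ⇒-Weakening
    ⇒-weakening weak a b c = begin
      a ⇒ b                         ≤⟨ Equivalence.to ⇐𝟘≤⇔≤𝟙⇒ a⇒b⇐𝟘≤a⇒b ⟩
      𝟙 ⇒ (a ⇒ b)                   ≤⟨ ⇒-antimonoˡ-≤ _ (𝟙-greatest c) ⟩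
      c ⇒ (a ⇒ b)                   ∎
      where
      a⇒b⇐𝟘≤a⇒b : (a ⇒ b) ⇐ 𝟘 ≤ a ⇒ b
      a⇒b⇐𝟘≤a⇒b = begin
        (a ⇒ b) ⇐ 𝟘                 ≤⟨ Equivalence.to ⇐𝟘≤⇔≤𝟙⇒ (weak (a ⇒ b) 𝟘 𝟘) ⟩
        𝟙 ⇒ ((a ⇒ b) ⇐ 𝟘)           ≤⟨ 𝟙⇒-⇐𝟘-≤-⇒ a b ⟩
        a ⇒ b                       ∎

  𝟙⇒-inflationary⇔⇐𝟘-deflationary : 𝟙⇒-Inflationary ⇔ ⇐𝟘-Deflationary
  𝟙⇒-inflationary⇔⇐𝟘-deflationary = mk⇔
    (λ infl a → Equivalence.from ⇐𝟘≤⇔≤𝟙⇒ (infl a))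
    (λ defl a → Equivalence.to ⇐𝟘≤⇔≤𝟙⇒ (defl a))

corollary4p9 : {c ℓ : Level} (A : WHBAlgebra c ℓ) →
    let open WHBAlgebra A in
    ((∀ a b → (a ∧ (a ⇒ b)) ≤ b) ⇔ (∀ a b → a ≤ (b ∨ (a ⇐ b))))
    × ((∀ a b c → (a ⇒ b) ≤ (c ⇒ (a ⇒ b))) ⇔ (∀ a b c → ((a ⇐ b) ⇐ c) ≤ (a ⇐ b)))
    × ((∀ a → a ≤ (𝟙 ⇒ a)) ⇔ (∀ a → (a ⇐ 𝟘) ≤ a))
corollary4p9 A =
  modusPonens⇔dualModusPonens , ⇒-weakening⇔⇐-weakening , 𝟙⇒-inflationary⇔⇐𝟘-deflationary
  where open WHBProperties A
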